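{- Let $n\ge1$, $m\ge1$, let $\pi\in\mathfrak S_n$, let $\mathbf a\in\mathbb N^n$ be the Pak–Stanley label of a region $R$ of the $n$-dimensional $m$-Catalan arrangement contained in the fundamental chamber, let $\mathbf b$ be the Pak–Stanley label of the region $\pi(R)$, and let $p\in\{0,1,\dots,(m-1)n\}$. Then: (1) for every $i\in[n]$, $i\in Z_p(\mathbf a)$ if and only if $\pi(i)\in Z_p(\mathbf b)$; (2) for all $i,j\in[n]$, if $i,j\in Z_p(\mathbf a)\setminus Z_{p-1}(\mathbf a)$ then $a_i=a_j$; (3) $\mathbf b-\mathbf p(\mathbf b)=\mathbf 1+I(\pi)$.
   Context: $\mathbb N=\{1,2,3,\dots\}$, $[n]=\{1,\dots,n\}$, $\mathbf 1=(1,\dots,1)$. The $n$-dimensional $m$-Catalan arrangement consists of the hyperplanes $\{x\in\mathbb R^n: x_i-x_j=a\}$ for $1\le i<j\le n$ and integers $a\in[-m,m]$; its regions are the connected components of the complement of their union. Let $R_0$ be the region containing the points with $x_1>\dots>x_n$ and $x_1-x_n<1$. The Pak–Stanley label of a region $R$ is $\mathbf 1+\sum_H e_{c(H)}$, summed over the hyperplanes $H$ separating $R$ from $R_0$, where for $H=\{x_i-x_j=a\}$ ($i<j$), $c(H)=j$ if $a>0$ and $c(H)=i$ if $a\le0$ ($e_k$ the standard basis vector). The fundamental chamber is $\{x_1>x_2>\dots>x_n\}$. $\pi\in\mathfrak S_n$ acts by $\pi(x_1,\dots,x_n)=(x_{\pi^{ -1}(1)},\dots,x_{\pi^{ -1}(n)})$.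 The inversion table of $\pi$ is $I(\pi)=(|\{j<\pi^{ -1}(i): \pi(j)>i\}|)_{1\le i\le n}$. For $\mathbf a\in\mathbb N^n$ and an integer $p$, the $p$-center $Z_p(\mathbf a)$ is the largest subset $X=\{x_1,\dots,x_q\}$ of $[n]$ with $x_q<x_{q-1}<\dots<x_1$ such that $a_{x_j}\le p+j$ for every $j\in[q]$ (so $Z_p(\mathbf a)=\varnothing$ for $p<0$). For $\mathbf b\in\mathbb N^n$, $\mathbf p(\mathbf b)\in\mathbb N^n$... more precisely $\mathbf p(\mathbf b)_i=j$ where $j$ is such that $i\in Z_j(\mathbf b)\setminus Z_{j-1}(\mathbf b)$. -}

module Defs where

open import Data.Bool using (Bool; true; false; _∧_; _xor_; if_then_else_)
open import Data.Nat as ℕ using (ℕ; zero; suc)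
open import Data.Integer as ℤ using (ℤ; +_; -_; _+_)
open import Data.Fin using (Fin; toℕ)
import Data.Fin.Properties as FinP
open import Data.Fin.Subset using (Subset; _∈_; _∪_; ⊥)
open import Data.Fin.Subset.Properties using (_∈?_)
open import Data.Fin.Permutation using (Permutation′; _⟨$⟩ʳ_; _⟨$⟩ˡ_)
open import Data.List using (List; []; _∷_; [_]; length; filter; map; concatMap; foldr; allFin; upTo)
open import Data.Vec using (_∷_; [])
open import Data.Rational.Unnormalised using (ℚᵘ; mkℚᵘ; _/_; _≃_)
import Data.Rational.Unnormalised as Q
import Data.Rational.Unnormalised.Properties as QP
import Data.Integer.Properties as ℤP
open import Data.Product using (_×_; ∃-syntax)
open import Relation.Nullary using (¬_; Dec; yes; no)
open import Relation.Nullary.Decidable using (⌊_⌋; _→-dec_)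
open import Relation.Binary.PropositionalEquality using (_≡_)

count : {n : ℕ} → (Fin n → Bool) → ℕ
count {n} P = length (filter (λ k → P k Data.Bool.≟ true) (allFin n))

Point : ℕ → Set
Point n = Fin n → ℚᵘ

ℤ→ℚ : ℤ → ℚᵘ
ℤ→ℚ a = a / 1

-- the hyperplane {x_i - x_j = a}
record Hyp (n : ℕ) : Set where
  constructor hyp
  field
    hi : Fin n
    hj : Fin n
    ha : ℤ
open Hyp public

intRange : ℕ → List ℤ
intRange m = map (λ k → (+ k) ℤ.- (+ m)) (upTo (suc (2 ℕ.* m)))

catalanHyps : (n m : ℕ) → List (Hyp n)
catalanHyps n m =
  filter (λ H → toℕ (hi H) ℕ.<? toℕ (hj H))
    (concatMap (λ i → concatMap (λ j → map (λ a → hyp i j a) (intRange m)) (allFin n)) (allFin n))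

Generic : {n : ℕ} → ℕ → Point n → Set
Generic {n} m x = (i j : Fin n) → toℕ i ℕ.< toℕ j → (a : ℤ) → - (+ m) ℤ.≤ a → a ℤ.≤ + m →
  ¬ (x i Q.- x j ≃ ℤ→ℚ a)

InFundamental : {n : ℕ} → Point n → Set
InFundamental {n} x = (i j : Fin n) → toℕ i ℕ.< toℕ j → x j Q.< x i

-- a reference point of R_0: r_k = (n - k)/n (k = 0,…,n-1), so x_1 > … > x_n, x_1 - x_n < 1
r0 : (n : ℕ) → Point n
r0 n k = mkℚᵘ (+ (n ℕ.∸ toℕ k)) (n ℕ.∸ 1)

below : {n : ℕ} → Point n → Hyp n → Bool
below y H = ⌊ y (hi H) Q.- y (hj H) QP.<? ℤ→ℚ (ha H) ⌋

separates : {n : ℕ} → Point n → Hyp n → Bool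
separates {n} x H = below x H xor below (r0 n) H

cH : {n : ℕ} → Hyp n → Fin n
cH H = if ⌊ + 0 ℤP.<? ha H ⌋ then hj H else hi H

label : {n : ℕ} → ℕ → Point n → Fin n → ℕ
label {n} m x k =
  suc (length (filter (λ H → (separates x H ∧ ⌊ cH H FinP.≟ k ⌋) Data.Bool.≟ true) (catalanHyps n m)))

act : {n : ℕ} → Permutation′ n → Point n → Point n
act π x k = x (π ⟨$⟩ˡ k)

invTable : {n : ℕ} → Permutation′ n → Fin n → ℕ
invTable π i = count (λ j → ⌊ toℕ j ℕ.<? toℕ (π ⟨$⟩ˡ i) ⌋ ∧ ⌊ toℕ i ℕ.<? toℕ (π ⟨$⟩ʳ j) ⌋)

-- position of i in X listed decreasingly x_1 > x_2 > …  (i.e. |{k ∈ X : k ≥ i}|)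
rank : {n : ℕ} → Subset n → Fin n → ℕ
rank X i = count (λ k → ⌊ k ∈? X ⌋ ∧ ⌊ toℕ i ℕ.≤? toℕ k ⌋)

Admissible : {n : ℕ} → ℤ → (Fin n → ℕ) → Subset n → Set
Admissible p a X = ∀ i → i ∈ X → + (a i) ℤ.≤ p + + (rank X i)

admissible? : {n : ℕ} (p : ℤ) (a : Fin n → ℕ) (X : Subset n) → Dec (Admissible p a X)
admissible? p a X = FinP.all? (λ i → (i ∈? X) →-dec (+ (a i) ℤP.≤? p + + (rank X i)))

allSubsets : (n : ℕ) → List (Subset n)
allSubsets zero = [ [] ]
allSubsets (suc n) = concatMap (λ s → (true ∷ s) ∷ (false ∷ s) ∷ []) (allSubsets n)

-- Z_p(a): the largest admissible subset, computed as the union of all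
-- admissible subsets (admissible sets are closed under union)
center : {n : ℕ} → ℤ → (Fin n → ℕ) → Subset n
center {n} p a = foldr _∪_ ⊥ (filter (admissible? p a) (allSubsets n))

-- i ∈ Z_j(b) ∖ Z_{j-1}(b), i.e. p(b)_i = j
IsPAt : {n : ℕ} → (Fin n → ℕ) → Fin n → ℤ → Set
IsPAt b i j = i ∈ center j b × ¬ (i ∈ center (j ℤ.- + 1) b)

-- Write the label at k as 1 plus, over the other coordinates l, the number of hyperplanes through
-- coordinates l and k that separate the region from R₀ and are charged to k.  This count depends
-- only on the order of l and k and on x_l - x_k, so passing from x in the fundamental chamber to
-- π(x) adds exactly the hyperplane x_l = x_k for every pair whose order π reverses; hence
-- b(π u) = a(u) + I(π)(π u) with a weakly increasing.  For labels of this shape the p-centers are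
-- thresholds: π u ∈ Z_p(b) iff a(u) ≤ p + 1, because the set of such π u is admissible and, by
-- downward induction, contains every admissible set.  Thus p(b)(π u) is a(u) - 1, which gives all
-- three claims.

module Submission where

open import Defs
open import Data.Nat using (ℕ; _≤_; _∸_; _*_)
open import Data.Integer using (ℤ; +_; -_; _-_)
open import Data.Fin using (Fin)
open import Data.Fin.Subset using (_∈_)
open import Data.Fin.Permutation using (Permutation′; _⟨$⟩ʳ_)
open import Data.Product using (_×_; ∃-syntax)
open import Function.Bundles using (_⇔_)
open import Relation.Binary.PropositionalEquality using (_≡_)

open import Data.Bool as Bool using (Bool; true; false; _∧_; _xor_; not; T; if_then_else_)
open import Data.Bool.Properties using (T-∧; T-≡; ∧-zeroʳ; ∧-identityʳ)
open import Data.Empty using (⊥-elim)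
open import Data.Fin as Fin using (toℕ; punchIn)
open import Data.Fin.Induction using (>-wellFounded)
import Data.Fin.Permutation as Perm
open import Data.Fin.Permutation using (_⟨$⟩ˡ_; inverseˡ; inverseʳ)
import Data.Fin.Properties as FinP
open import Data.Fin.Subset using (Subset; _∪_; ⊥)
open import Data.Fin.Subset.Properties using (_∈?_; x∈p∪q⁺; x∈p∪q⁻; ∉⊥)
import Data.Integer as ℤ
import Data.Integer.Properties as ℤP
open import Data.Integer.Tactic.RingSolver renaming (solve-∀ to solve-∀ℤ)
open import Data.List as L using (List; []; _∷_; [_]; _++_; filter; length; map; concatMap; tabulate; allFin; upTo; applyUpTo)
open import Data.List.Membership.Propositional using () renaming (_∈_ to _∈ᴸ_)
open import Data.List.Membership.Propositional.Properties using (∈-concatMap⁺; ∈-filter⁺; ∈-filter⁻)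
open import Data.List.Properties using (map-++; map-tabulate; map-cong; map-∘; map-upTo; applyUpTo-∷ʳ)
open import Data.List.Relation.Unary.Any as Any using (here; there)
open import Data.Nat as ℕ using (zero; suc; z≤n; s≤s)
import Data.Nat.ListAction as List
open import Data.Nat.ListAction.Properties using (sum-++)
import Data.Nat.Properties as ℕP
open import Data.Nat.Tactic.RingSolver using (solve-∀)
open import Data.Product using (_,_; proj₁; proj₂)
open import Data.Rational.Unnormalised as ℚ using (ℚᵘ; _≃_; *<*; *≤*; 0ℚᵘ)
import Data.Rational.Unnormalised.Properties as ℚP
open import Data.Sum using (inj₁; inj₂)
import Data.Vec as Vec
open import Data.Vec.Properties using (lookup∘tabulate; []=⇒lookup; lookup⇒[]=)
open import Function using (_∘_; _$_)
open import Function.Bundles using (mk⇔; Equivalence)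
open import Function.Properties.Equivalence using () renaming (sym to ⇔-sym; trans to ⇔-trans)
open import Induction.WellFounded using (module All)
open import Level using (0ℓ)
open import Relation.Binary using (tri<; tri≈; tri>)
open import Relation.Binary.PropositionalEquality hiding ([_])
open import Relation.Nullary using (¬_; Dec; yes; no; does)
open import Relation.Nullary.Decidable using (⌊_⌋; isYes≗does; dec-true; dec-false; does-⇔; toWitness; fromWitness)
open import Relation.Unary using (Decidable)

open import Algebra.Properties.CommutativeMonoid.Sum ℕP.+-0-commutativeMonoid
  using (sum; sum-syntax; ∑-distrib-+; ∑-permute; sum-cong-≗; sum-remove)

private
  variable
    A B : Set
    n : ℕ

𝟙 : Bool → ℕ
𝟙 true  = 1
𝟙 false = 0

⌊⌋-true : (a? : Dec A) → A → ⌊ a? ⌋ ≡ true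
⌊⌋-true a? a = trans (isYes≗does a?) (dec-true a? a)

⌊⌋-false : (a? : Dec A) → ¬ A → ⌊ a? ⌋ ≡ false
⌊⌋-false a? ¬a = trans (isYes≗does a?) (dec-false a? ¬a)

⌊⌋-⇔ : A ⇔ B → (a? : Dec A) (b? : Dec B) → ⌊ a? ⌋ ≡ ⌊ b? ⌋
⌊⌋-⇔ A⇔B a? b? = trans (isYes≗does a?) (trans (does-⇔ A⇔B a? b?) (sym (isYes≗does b?)))

does-≟-true : ∀ b → does (b Bool.≟ true) ≡ b
does-≟-true true  = refl
does-≟-true false = refl

xor-trueʳ : ∀ b → b xor true ≡ not b
xor-trueʳ true  = refl
xor-trueʳ false = refl

xor-falseʳ : ∀ b → b xor false ≡ b
xor-falseʳ true  = refl
xor-falseʳ false = refl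

𝟙-mono : ∀ {b c} → (T b → T c) → 𝟙 b ℕ.≤ 𝟙 c
𝟙-mono {false} _ = z≤n
𝟙-mono {true} {true} _ = s≤s z≤n
𝟙-mono {true} {false} b⇒c with () ← b⇒c _

T-⌊⌋∧⌊⌋ : (a? : Dec A) (b? : Dec B) → T (⌊ a? ⌋ ∧ ⌊ b? ⌋) ⇔ (A × B)
T-⌊⌋∧⌊⌋ a? b? = mk⇔
  (λ t → let ta , tb = Equivalence.to (T-∧ {⌊ a? ⌋} {⌊ b? ⌋}) t in toWitness ta , toWitness tb)
  (λ (a , b) → Equivalence.from (T-∧ {⌊ a? ⌋} {⌊ b? ⌋}) (fromWitness a , fromWitness b))

sum-mono-≤ : {f g : Fin n → ℕ} → (∀ i → f i ℕ.≤ g i) → sum f ℕ.≤ sum g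
sum-mono-≤ {zero}  _   = z≤n
sum-mono-≤ {suc n} f≤g = ℕP.+-mono-≤ (f≤g Fin.zero) (sum-mono-≤ (f≤g ∘ Fin.suc))

sum-zero : {f : Fin n → ℕ} → (∀ i → f i ≡ 0) → sum f ≡ 0
sum-zero {zero}  _   = refl
sum-zero {suc n} f≡0 = cong₂ ℕ._+_ (f≡0 Fin.zero) (sum-zero (f≡0 ∘ Fin.suc))

sum-supported-at : ∀ {f : Fin n → ℕ} k → (∀ i → i ≢ k → f i ≡ 0) → sum f ≡ f k
sum-supported-at {suc n} {f} k f≡0 = begin
  sum f                               ≡⟨ sum-remove f ⟩
  f k ℕ.+ sum (λ i → f (punchIn k i)) ≡⟨ cong (f k ℕ.+_) (sum-zero (λ i → f≡0 _ (FinP.punchInᵢ≢i k i))) ⟩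
  f k ℕ.+ 0                           ≡⟨ ℕP.+-identityʳ (f k) ⟩
  f k                                 ∎
  where open ≡-Reasoning

sum-𝟙≟ : (k : Fin n) → ∑[ i < n ] 𝟙 ⌊ i FinP.≟ k ⌋ ≡ 1
sum-𝟙≟ k = trans (sum-supported-at k (λ i i≢k → cong 𝟙 (⌊⌋-false (i FinP.≟ k) i≢k))) (cong 𝟙 (⌊⌋-true (k FinP.≟ k) refl))

⟨$⟩ʳ-injective : (π : Permutation′ n) {u v : Fin n} → π ⟨$⟩ʳ u ≡ π ⟨$⟩ʳ v → u ≡ v
⟨$⟩ʳ-injective π eq = trans (sym (inverseˡ π)) (trans (cong (π ⟨$⟩ˡ_) eq) (inverseˡ π))

⟨$⟩ˡ-injective : (π : Permutation′ n) {u v : Fin n} → π ⟨$⟩ˡ u ≡ π ⟨$⟩ˡ v → u ≡ v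
⟨$⟩ˡ-injective π eq = trans (sym (inverseʳ π)) (trans (cong (π ⟨$⟩ʳ_) eq) (inverseʳ π))

sum-sum-through : ∀ {W : Fin (suc n) → Fin (suc n) → ℕ} k →
  (∀ i j → i ≢ k → j ≢ k → W i j ≡ 0) → W k k ≡ 0 →
  ∑[ i < suc n ] ∑[ j < suc n ] W i j ≡ ∑[ l < suc n ] (W l k ℕ.+ W k l)
sum-sum-through {n} {W} k W≡0 Wkk≡0 = begin
  ∑[ i < suc n ] ∑[ j < suc n ] W i j                          ≡⟨ sum-remove (λ i → ∑[ j < suc n ] W i j) ⟩
  ∑[ j < suc n ] W k j ℕ.+ ∑[ i < n ] ∑[ j < suc n ] W (punchIn k i) j
    ≡⟨ cong (∑[ j < suc n ] W k j ℕ.+_) (sum-cong-≗ (λ i → sum-supported-at k (λ j → W≡0 _ j (FinP.punchInᵢ≢i k i)))) ⟩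
  ∑[ j < suc n ] W k j ℕ.+ ∑[ i < n ] W (punchIn k i) k          ≡⟨ cong (∑[ j < suc n ] W k j ℕ.+_) (sym column) ⟩
  ∑[ j < suc n ] W k j ℕ.+ ∑[ l < suc n ] W l k                  ≡⟨ ℕP.+-comm (∑[ j < suc n ] W k j) _ ⟩
  ∑[ l < suc n ] W l k ℕ.+ ∑[ l < suc n ] W k l                  ≡⟨ sym (∑-distrib-+ (λ l → W l k) (W k)) ⟩
  ∑[ l < suc n ] (W l k ℕ.+ W k l)                               ∎
  where
  open ≡-Reasoning
  column : ∑[ l < suc n ] W l k ≡ ∑[ i < n ] W (punchIn k i) k
  column = trans (sum-remove (λ l → W l k)) (cong (ℕ._+ ∑[ i < n ] W (punchIn k i) k) Wkk≡0)

length-filter : {P : A → Set} (P? : Decidable P) (xs : List A) →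
  length (filter P? xs) ≡ List.sum (map (𝟙 ∘ does ∘ P?) xs)
length-filter P? []       = refl
length-filter P? (x ∷ xs) with does (P? x)
... | true  = cong suc (length-filter P? xs)
... | false = length-filter P? xs

sum-map-filter : {P : A → Set} (P? : Decidable P) (f : A → ℕ) (xs : List A) →
  List.sum (map f (filter P? xs)) ≡ List.sum (map (λ x → if does (P? x) then f x else 0) xs)
sum-map-filter P? f []       = refl
sum-map-filter P? f (x ∷ xs) with does (P? x)
... | true  = cong (f x ℕ.+_) (sum-map-filter P? f xs)
... | false = sum-map-filter P? f xs

sum-map-concatMap : (f : B → ℕ) (g : A → List B) (xs : List A) →
  List.sum (map f (concatMap g xs)) ≡ List.sum (map (λ x → List.sum (map f (g x))) xs)
sum-map-concatMap f g []       = refl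
sum-map-concatMap f g (x ∷ xs) = begin
  List.sum (map f (g x L.++ concatMap g xs))                  ≡⟨ cong List.sum (map-++ f (g x) _) ⟩
  List.sum (map f (g x) L.++ map f (concatMap g xs))          ≡⟨ sum-++ (map f (g x)) _ ⟩
  List.sum (map f (g x)) ℕ.+ List.sum (map f (concatMap g xs)) ≡⟨ cong (_ ℕ.+_) (sum-map-concatMap f g xs) ⟩
  List.sum (map (λ x → List.sum (map f (g x))) (x ∷ xs))     ∎
  where open ≡-Reasoning

sum-tabulate : (f : Fin n → ℕ) → List.sum (tabulate f) ≡ sum f
sum-tabulate {zero}  f = refl
sum-tabulate {suc n} f = cong (f Fin.zero ℕ.+_) (sum-tabulate (f ∘ Fin.suc))

sum-map-allFin : (f : Fin n → ℕ) → List.sum (map f (allFin n)) ≡ sum f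
sum-map-allFin f = trans (cong List.sum (map-tabulate (λ i → i) f)) (sum-tabulate f)

count≡sum : (P : Fin n → Bool) → count P ≡ ∑[ k < n ] 𝟙 (P k)
count≡sum {n} P = begin
  count P                                               ≡⟨ length-filter (λ k → P k Bool.≟ true) (allFin n) ⟩
  List.sum (map (λ k → 𝟙 (does (P k Bool.≟ true))) (allFin n)) ≡⟨ sum-map-allFin (λ k → 𝟙 (does (P k Bool.≟ true))) ⟩
  ∑[ k < n ] 𝟙 (does (P k Bool.≟ true))                   ≡⟨ sum-cong-≗ (cong 𝟙 ∘ does-≟-true ∘ P) ⟩
  ∑[ k < n ] 𝟙 (P k)                                      ∎
  where open ≡-Reasoning

count-mono : {P Q : Fin n → Bool} → (∀ k → T (P k) → T (Q k)) → count P ℕ.≤ count Q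
count-mono {P = P} {Q} P⇒Q =
  subst₂ ℕ._≤_ (sym (count≡sum P)) (sym (count≡sum Q)) (sum-mono-≤ (λ k → 𝟙-mono (P⇒Q k)))

sum-map-cong : {f g : A → ℕ} (xs : List A) → (∀ x → f x ≡ g x) → List.sum (map f xs) ≡ List.sum (map g xs)
sum-map-cong xs f≗g = cong List.sum (map-cong f≗g xs)

sum-map-zero : {f : A → ℕ} (xs : List A) → (∀ x → f x ≡ 0) → List.sum (map f xs) ≡ 0
sum-map-zero []       _   = refl
sum-map-zero (x ∷ xs) f≡0 = cong₂ ℕ._+_ (f≡0 x) (sum-map-zero xs f≡0)

sum-map-mono-≤ : {f g : A → ℕ} (xs : List A) → (∀ x → f x ℕ.≤ g x) →
  List.sum (map f xs) ℕ.≤ List.sum (map g xs)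
sum-map-mono-≤ []       _   = z≤n
sum-map-mono-≤ (x ∷ xs) f≤g = ℕP.+-mono-≤ (f≤g x) (sum-map-mono-≤ xs f≤g)

+k-+suc : ∀ k m → + suc k ℤ.- + suc m ≡ + k ℤ.- + m
+k-+suc k m = begin
  + suc k ℤ.- + suc m ≡⟨ ℤP.[+m]-[+n]≡m⊖n (suc k) (suc m) ⟩
  suc k ℤ.⊖ suc m     ≡⟨ ℤP.[1+m]⊖[1+n]≡m⊖n k m ⟩
  k ℤ.⊖ m             ≡⟨ ℤP.[+m]-[+n]≡m⊖n k m ⟨
  + k ℤ.- + m         ∎
  where open ≡-Reasoning

intRange-suc : ∀ m → intRange (suc m) ≡ - (+ suc m) ∷ intRange m ++ [ + suc m ]
intRange-suc m = cong (- (+ suc m) ∷_) $ begin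
  map shift (applyUpTo suc (suc K))           ≡⟨ cong (map shift) (applyUpTo-∷ʳ suc K) ⟨
  map shift (applyUpTo suc K ++ [ suc K ])    ≡⟨ map-++ shift (applyUpTo suc K) [ suc K ] ⟩
  map shift (applyUpTo suc K) ++ [ shift (suc K) ] ≡⟨ cong₂ (λ xs y → xs ++ [ y ]) inner last ⟩
  intRange m ++ [ + suc m ]                   ∎
  where
  open ≡-Reasoning
  shift : ℕ → ℤ
  shift k = + k ℤ.- + suc m
  K : ℕ
  K = m ℕ.+ suc (m ℕ.+ 0)   -- 2 * suc m unfolds to suc K
  inner : map shift (applyUpTo suc K) ≡ intRange m
  inner = begin
    map shift (applyUpTo suc K)         ≡⟨ cong (map shift) (map-upTo suc K) ⟨
    map shift (map suc (upTo K))        ≡⟨ map-∘ (upTo K) ⟨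
    map (shift ∘ suc) (upTo K)          ≡⟨ map-cong (λ k → +k-+suc k m) (upTo K) ⟩
    map (λ k → + k ℤ.- + m) (upTo K)    ≡⟨ cong (map (λ k → + k ℤ.- + m) ∘ upTo) (ℕP.+-suc m (m ℕ.+ 0)) ⟩
    intRange m                          ∎
  last : shift (suc K) ≡ + suc m
  last = begin
    shift (suc K)       ≡⟨ ℤP.[+m]-[+n]≡m⊖n (suc K) (suc m) ⟩
    suc K ℤ.⊖ suc m     ≡⟨ ℤP.⊖-≥ (s≤s (ℕP.m≤m+n m _)) ⟩
    + (K ℕ.∸ m)         ≡⟨ cong +_ (ℕP.m+n∸m≡n m (suc (m ℕ.+ 0))) ⟩
    + suc (m ℕ.+ 0)     ≡⟨ cong (+_ ∘ suc) (ℕP.+-identityʳ m) ⟩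
    + suc m             ∎

sum-intRange-pairs : ∀ m (f g : ℤ → ℕ) d → f (+ 0) ≡ d ℕ.+ g (+ 0) →
  (∀ s → 1 ℕ.≤ s → s ℕ.≤ m → f (+ s) ℕ.+ f (- + s) ≡ g (+ s) ℕ.+ g (- + s)) →
  List.sum (map f (intRange m)) ≡ d ℕ.+ List.sum (map g (intRange m))
sum-intRange-pairs zero    f g d f0 _    = trans (cong (ℕ._+ 0) f0) (ℕP.+-assoc d (g (+ 0)) 0)
sum-intRange-pairs (suc m) f g d f0 pair = begin
  List.sum (map f (intRange (suc m)))                  ≡⟨ sum-around f ⟩
  (f (+ suc m) ℕ.+ f (- + suc m)) ℕ.+ List.sum (map f (intRange m))
    ≡⟨ cong₂ ℕ._+_ (pair (suc m) (s≤s z≤n) ℕP.≤-refl)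
         (sum-intRange-pairs m f g d f0 (λ s 1≤s s≤m → pair s 1≤s (ℕP.m≤n⇒m≤1+n s≤m))) ⟩
  (g (+ suc m) ℕ.+ g (- + suc m)) ℕ.+ (d ℕ.+ List.sum (map g (intRange m)))
    ≡⟨ x+[y+z]≡y+[x+z] (g (+ suc m) ℕ.+ g (- + suc m)) d _ ⟩
  d ℕ.+ ((g (+ suc m) ℕ.+ g (- + suc m)) ℕ.+ List.sum (map g (intRange m))) ≡⟨ cong (d ℕ.+_) (sum-around g) ⟨
  d ℕ.+ List.sum (map g (intRange (suc m)))          ∎
  where
  open ≡-Reasoning
  x+[y+z]≡y+[x+z] : ∀ x y z → x ℕ.+ (y ℕ.+ z) ≡ y ℕ.+ (x ℕ.+ z)
  x+[y+z]≡y+[x+z] = solve-∀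
  sum-around : ∀ (h : ℤ → ℕ) → List.sum (map h (intRange (suc m))) ≡
               (h (+ suc m) ℕ.+ h (- + suc m)) ℕ.+ List.sum (map h (intRange m))
  sum-around h = begin
    List.sum (map h (intRange (suc m)))            ≡⟨ cong (List.sum ∘ map h) (intRange-suc m) ⟩
    h (- + suc m) ℕ.+ List.sum (map h (intRange m ++ [ + suc m ]))
      ≡⟨ cong (λ xs → h (- + suc m) ℕ.+ List.sum xs) (map-++ h (intRange m) [ + suc m ]) ⟩
    h (- + suc m) ℕ.+ List.sum (map h (intRange m) ++ [ h (+ suc m) ])
      ≡⟨ cong (h (- + suc m) ℕ.+_) (sum-++ (map h (intRange m)) [ h (+ suc m) ]) ⟩
    h (- + suc m) ℕ.+ (List.sum (map h (intRange m)) ℕ.+ (h (+ suc m) ℕ.+ 0))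
      ≡⟨ rotate (h (- + suc m)) (List.sum (map h (intRange m))) (h (+ suc m)) ⟩
    (h (+ suc m) ℕ.+ h (- + suc m)) ℕ.+ List.sum (map h (intRange m)) ∎
    where
    rotate : ∀ x y z → x ℕ.+ (y ℕ.+ (z ℕ.+ 0)) ≡ (z ℕ.+ x) ℕ.+ y
    rotate = solve-∀

ℤ→ℚ-mono-≤ : ∀ {a b} → a ℤ.≤ b → ℤ→ℚ a ℚ.≤ ℤ→ℚ b
ℤ→ℚ-mono-≤ {a} {b} a≤b = *≤* (subst₂ ℤ._≤_ (sym (ℤP.*-identityʳ a)) (sym (ℤP.*-identityʳ b)) a≤b)

ℤ→ℚ-mono-< : ∀ {a b} → a ℤ.< b → ℤ→ℚ a ℚ.< ℤ→ℚ b
ℤ→ℚ-mono-< {a} {b} a<b = *<* (subst₂ ℤ._<_ (sym (ℤP.*-identityʳ a)) (sym (ℤP.*-identityʳ b)) a<b)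

p<q⇒0<q-p : ∀ {p q} → p ℚ.< q → 0ℚᵘ ℚ.< q ℚ.- p
p<q⇒0<q-p {p} p<q = ℚP.<-respˡ-≃ (ℚP.+-inverseʳ p) (ℚP.+-monoˡ-< (ℚ.- p) p<q)

neg-[p-q]≃q-p : ∀ p q → ℚ.- (p ℚ.- q) ≃ q ℚ.- p
neg-[p-q]≃q-p p q = ℚP.≃-trans
  (ℚP.≃-reflexive (trans (ℚP.neg-distrib-+ p (ℚ.- q)) (cong (ℚ.- p ℚ.+_) (ℚP.neg-involutive-≡ q))))
  (ℚP.+-comm (ℚ.- p) q)

p<q⇒p-q<0 : ∀ {p q} → p ℚ.< q → p ℚ.- q ℚ.< 0ℚᵘ
p<q⇒p-q<0 {p} {q} p<q = ℚP.<-respˡ-≃ (neg-[p-q]≃q-p q p) (ℚP.neg-mono-< (p<q⇒0<q-p p<q))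

<ℤ→ℚ⇔0< : ∀ {d} a → 0ℚᵘ ℚ.< d → d ℚ.< ℤ→ℚ (+ 1) → (d ℚ.< ℤ→ℚ a) ⇔ (+ 0 ℤ.< a)
<ℤ→ℚ⇔0< {d} a 0<d d<1 = mk⇔ to from
  where
  to : d ℚ.< ℤ→ℚ a → + 0 ℤ.< a
  to d<a with + 0 ℤP.<? a
  ... | yes 0<a = 0<a
  ... | no  0≮a = ⊥-elim (ℚP.<-irrefl ℚP.≃-refl
                    (ℚP.<-≤-trans (ℚP.<-trans 0<d d<a) (ℤ→ℚ-mono-≤ (ℤP.≮⇒≥ 0≮a))))
  from : + 0 ℤ.< a → d ℚ.< ℤ→ℚ a
  from 0<a = ℚP.<-≤-trans d<1 (ℤ→ℚ-mono-≤ (ℤP.i<j⇒suc[i]≤j 0<a))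

module _ {n : ℕ} where

  r0-decreasing : (i j : Fin (suc n)) → toℕ i ℕ.< toℕ j → r0 (suc n) j ℚ.< r0 (suc n) i
  r0-decreasing i j i<j =
    *<* (ℤP.*-monoʳ-<-pos (+ suc n) (ℤ.+<+ (ℕP.∸-monoʳ-< i<j (ℕP.<⇒≤ (FinP.toℕ<n j)))))

  r0-positive : (j : Fin (suc n)) → 0ℚᵘ ℚ.< r0 (suc n) j
  r0-positive j = *<* (subst (+ 0 ℤ.<_) (sym (ℤP.*-identityʳ (+ (suc n ℕ.∸ toℕ j))))
    (ℤ.+<+ (ℕP.m<n⇒0<n∸m (FinP.toℕ<n j))))

  r0-≤1 : (i : Fin (suc n)) → r0 (suc n) i ℚ.≤ ℤ→ℚ (+ 1)
  r0-≤1 i = *≤* (subst₂ ℤ._≤_ (sym (ℤP.*-identityʳ (+ (suc n ℕ.∸ toℕ i)))) (sym (ℤP.*-identityˡ (+ suc n)))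
    (ℤ.+≤+ (ℕP.m∸n≤m (suc n) (toℕ i))))

  below-r0 : ∀ (i j : Fin (suc n)) a → toℕ i ℕ.< toℕ j → below (r0 (suc n)) (hyp i j a) ≡ ⌊ + 0 ℤP.<? a ⌋
  below-r0 i j a i<j = ⌊⌋-⇔ (<ℤ→ℚ⇔0< a 0<d d<1) (d ℚP.<? ℤ→ℚ a) (+ 0 ℤP.<? a)
    where
    d : ℚᵘ
    d = r0 (suc n) i ℚ.- r0 (suc n) j
    0<d : 0ℚᵘ ℚ.< d
    0<d = p<q⇒0<q-p (r0-decreasing i j i<j)
    d<1 : d ℚ.< ℤ→ℚ (+ 1)
    d<1 = ℚP.<-≤-trans
      (ℚP.<-respʳ-≃ (ℚP.+-identityʳ (r0 (suc n) i)) (ℚP.+-monoʳ-< (r0 (suc n) i) (ℚP.neg-mono-< (r0-positive j))))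
      (r0-≤1 i)

counted : Point n → Fin n → Hyp n → Bool
counted y k H = does (toℕ (hi H) ℕ.<? toℕ (hj H)) ∧ (separates y H ∧ ⌊ cH H FinP.≟ k ⌋)

hypCount : ℕ → Point n → Fin n → Fin n → Fin n → ℕ
hypCount m y k i j = List.sum (map (λ a → 𝟙 (counted y k (hyp i j a))) (intRange m))

pairCount : ℕ → Point n → Fin n → Fin n → ℕ
pairCount m y k l = hypCount m y k l k ℕ.+ hypCount m y k k l

label≡suc-∑∑hypCount : ∀ m (y : Point n) k →
  label m y k ≡ suc (∑[ i < n ] ∑[ j < n ] hypCount m y k i j)
label≡suc-∑∑hypCount {n} m y k = cong suc $ begin
  length (filter Sep? (filter Lt? hyps))                          ≡⟨ length-filter Sep? (filter Lt? hyps) ⟩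
  List.sum (map (𝟙 ∘ does ∘ Sep?) (filter Lt? hyps))              ≡⟨ sum-map-filter Lt? (𝟙 ∘ does ∘ Sep?) hyps ⟩
  List.sum (map (λ H → if does (Lt? H) then 𝟙 (does (Sep? H)) else 0) hyps)
    ≡⟨ sum-map-cong hyps (λ H → if-𝟙 (does (Lt? H)) (separates y H ∧ ⌊ cH H FinP.≟ k ⌋)) ⟩
  List.sum (map (𝟙 ∘ counted y k) hyps)                           ≡⟨ sum-map-concatMap (𝟙 ∘ counted y k) row (allFin n) ⟩
  List.sum (map (λ i → List.sum (map (𝟙 ∘ counted y k) (row i))) (allFin n))
    ≡⟨ sum-map-allFin (λ i → List.sum (map (𝟙 ∘ counted y k) (row i))) ⟩
  ∑[ i < n ] List.sum (map (𝟙 ∘ counted y k) (row i))             ≡⟨ sum-cong-≗ rowSum ⟩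
  ∑[ i < n ] ∑[ j < n ] hypCount m y k i j                        ∎
  where
  open ≡-Reasoning
  Lt? : Decidable (λ (H : Hyp n) → toℕ (hi H) ℕ.< toℕ (hj H))
  Lt? H = toℕ (hi H) ℕ.<? toℕ (hj H)
  Sep? : Decidable (λ (H : Hyp n) → (separates y H ∧ ⌊ cH H FinP.≟ k ⌋) ≡ true)
  Sep? H = (separates y H ∧ ⌊ cH H FinP.≟ k ⌋) Bool.≟ true
  row : Fin n → List (Hyp n)
  row i = concatMap (λ j → map (hyp i j) (intRange m)) (allFin n)
  hyps : List (Hyp n)
  hyps = concatMap row (allFin n)
  if-𝟙 : ∀ b c → (if b then 𝟙 (does (c Bool.≟ true)) else 0) ≡ 𝟙 (b ∧ c)
  if-𝟙 true  c = cong 𝟙 (does-≟-true c)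
  if-𝟙 false c = refl
  rowSum : ∀ i → List.sum (map (𝟙 ∘ counted y k) (row i)) ≡ ∑[ j < n ] hypCount m y k i j
  rowSum i = begin
    List.sum (map (𝟙 ∘ counted y k) (row i))
      ≡⟨ sum-map-concatMap (𝟙 ∘ counted y k) (λ j → map (hyp i j) (intRange m)) (allFin n) ⟩
    List.sum (map (λ j → List.sum (map (𝟙 ∘ counted y k) (map (hyp i j) (intRange m)))) (allFin n))
      ≡⟨ sum-map-allFin (λ j → List.sum (map (𝟙 ∘ counted y k) (map (hyp i j) (intRange m)))) ⟩
    ∑[ j < n ] List.sum (map (𝟙 ∘ counted y k) (map (hyp i j) (intRange m)))
      ≡⟨ sum-cong-≗ (λ j → cong List.sum (map-∘ {g = 𝟙 ∘ counted y k} {f = hyp i j} (intRange m))) ⟨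
    ∑[ j < n ] hypCount m y k i j ∎

counted-≮ : ∀ (y : Point n) k i j a → ¬ (toℕ i ℕ.< toℕ j) → counted y k (hyp i j a) ≡ false
counted-≮ y k i j a i≮j rewrite dec-false (toℕ i ℕ.<? toℕ j) i≮j = refl

cH≢ : ∀ {k} (i j : Fin n) a → i ≢ k → j ≢ k → ⌊ cH (hyp i j a) FinP.≟ k ⌋ ≡ false
cH≢ {k = k} i j a i≢k j≢k with + 0 ℤP.<? a
... | yes _ = ⌊⌋-false (j FinP.≟ k) j≢k
... | no  _ = ⌊⌋-false (i FinP.≟ k) i≢k

counted-off : ∀ (y : Point n) {k} i j a → i ≢ k → j ≢ k → counted y k (hyp i j a) ≡ false
counted-off y i j a i≢k j≢k
  rewrite cH≢ i j a i≢k j≢k | ∧-zeroʳ (separates y (hyp i j a)) = ∧-zeroʳ (does (toℕ i ℕ.<? toℕ j))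

posBelow : ℚᵘ → ℤ → Bool
posBelow e a = ⌊ + 0 ℤP.<? a ⌋ ∧ not ⌊ e ℚP.<? ℤ→ℚ a ⌋

nonposAbove : ℚᵘ → ℤ → Bool
nonposAbove e a = not ⌊ + 0 ℤP.<? a ⌋ ∧ ⌊ e ℚP.<? ℤ→ℚ a ⌋

#posBelow : ℕ → ℚᵘ → ℕ
#posBelow m e = List.sum (map (𝟙 ∘ posBelow e) (intRange m))

#nonposAbove : ℕ → ℚᵘ → ℕ
#nonposAbove m e = List.sum (map (𝟙 ∘ nonposAbove e) (intRange m))

module _ {n : ℕ} (m : ℕ) (y : Point (suc n)) where

  counted-into : ∀ l k a → toℕ l ℕ.< toℕ k → counted y k (hyp l k a) ≡ posBelow (y l ℚ.- y k) a
  counted-into l k a l<k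
    rewrite dec-true (toℕ l ℕ.<? toℕ k) l<k | below-r0 l k a l<k with + 0 ℤP.<? a
  ... | yes _ rewrite ⌊⌋-true (k FinP.≟ k) refl = trans (∧-identityʳ _) (xor-trueʳ _)
  ... | no  _ rewrite ⌊⌋-false (l FinP.≟ k) (ℕP.<⇒≢ l<k ∘ cong toℕ) = ∧-zeroʳ _

  counted-outof : ∀ k l a → toℕ k ℕ.< toℕ l → counted y k (hyp k l a) ≡ nonposAbove (y k ℚ.- y l) a
  counted-outof k l a k<l
    rewrite dec-true (toℕ k ℕ.<? toℕ l) k<l | below-r0 k l a k<l with + 0 ℤP.<? a
  ... | yes _ rewrite ⌊⌋-false (l FinP.≟ k) (ℕP.<⇒≢ k<l ∘ cong toℕ ∘ sym) = ∧-zeroʳ _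
  ... | no  _ rewrite ⌊⌋-true (k FinP.≟ k) refl = trans (∧-identityʳ _) (xor-falseʳ _)

  hypCount-≮ : ∀ k i j → ¬ (toℕ i ℕ.< toℕ j) → hypCount m y k i j ≡ 0
  hypCount-≮ k i j i≮j = sum-map-zero (intRange m) (λ a → cong 𝟙 (counted-≮ y k i j a i≮j))

  pairCount-into : ∀ k l → toℕ l ℕ.< toℕ k → pairCount m y k l ≡ #posBelow m (y l ℚ.- y k)
  pairCount-into k l l<k = begin
    hypCount m y k l k ℕ.+ hypCount m y k k l  ≡⟨ cong (hypCount m y k l k ℕ.+_) (hypCount-≮ k k l (ℕP.<⇒≯ l<k)) ⟩
    hypCount m y k l k ℕ.+ 0                   ≡⟨ ℕP.+-identityʳ _ ⟩
    hypCount m y k l k                         ≡⟨ sum-map-cong (intRange m) (λ a → cong 𝟙 (counted-into l k a l<k)) ⟩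
    #posBelow m (y l ℚ.- y k)                  ∎
    where open ≡-Reasoning

  pairCount-outof : ∀ k l → toℕ k ℕ.< toℕ l → pairCount m y k l ≡ #nonposAbove m (y k ℚ.- y l)
  pairCount-outof k l k<l = begin
    hypCount m y k l k ℕ.+ hypCount m y k k l  ≡⟨ cong (ℕ._+ hypCount m y k k l) (hypCount-≮ k l k (ℕP.<⇒≯ k<l)) ⟩
    hypCount m y k k l                         ≡⟨ sum-map-cong (intRange m) (λ a → cong 𝟙 (counted-outof k l a k<l)) ⟩
    #nonposAbove m (y k ℚ.- y l)               ∎
    where open ≡-Reasoning

  pairCount-self : ∀ k → pairCount m y k k ≡ 0
  pairCount-self k = cong₂ ℕ._+_ (hypCount-≮ k k k (ℕP.<-irrefl refl)) (hypCount-≮ k k k (ℕP.<-irrefl refl))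

  label≡suc-∑pairCount : ∀ k → label m y k ≡ suc (∑[ l < suc n ] pairCount m y k l)
  label≡suc-∑pairCount k = trans (label≡suc-∑∑hypCount m y k) (cong suc (sum-sum-through k
    (λ i j i≢k j≢k → sum-map-zero (intRange m) (λ a → cong 𝟙 (counted-off y i j a i≢k j≢k)))
    (hypCount-≮ k k k (ℕP.<-irrefl refl))))

#posBelow-neg : ∀ m {e} → e ℚ.< 0ℚᵘ → #posBelow m e ≡ 0
#posBelow-neg m {e} e<0 = sum-map-zero (intRange m) none
  where
  none : ∀ a → 𝟙 (posBelow e a) ≡ 0
  none a with + 0 ℤP.<? a
  ... | no  _   = refl
  ... | yes 0<a rewrite ⌊⌋-true (e ℚP.<? ℤ→ℚ a) (ℚP.<-trans e<0 (ℤ→ℚ-mono-< 0<a)) = refl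

#nonposAbove-pos : ∀ m {e} → 0ℚᵘ ℚ.< e → #nonposAbove m e ≡ 0
#nonposAbove-pos m {e} 0<e = sum-map-zero (intRange m) none
  where
  none : ∀ a → 𝟙 (nonposAbove e a) ≡ 0
  none a with + 0 ℤP.<? a
  ... | yes _   = refl
  ... | no  0≮a rewrite ⌊⌋-false (e ℚP.<? ℤ→ℚ a) (λ e<a → ℚP.<-irrefl ℚP.≃-refl
          (ℚP.<-≤-trans (ℚP.<-trans 0<e e<a) (ℤ→ℚ-mono-≤ (ℤP.≮⇒≥ 0≮a)))) = refl

#posBelow-mono : ∀ m {e e′} → e ℚ.≤ e′ → #posBelow m e ℕ.≤ #posBelow m e′
#posBelow-mono m {e} {e′} e≤e′ = sum-map-mono-≤ (intRange m) (λ a → 𝟙-mono (mono a))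
  where
  mono : ∀ a → T (posBelow e a) → T (posBelow e′ a)
  mono a with ⌊ + 0 ℤP.<? a ⌋ | e ℚP.<? ℤ→ℚ a | e′ ℚP.<? ℤ→ℚ a
  ... | true | no e≮a | yes e′<a = ⊥-elim (e≮a (ℚP.≤-<-trans e≤e′ e′<a))
  ... | true | no _   | no _     = _

<-flip : ∀ {e q} → ¬ (e ≃ q) → ⌊ q ℚP.<? e ⌋ ≡ not ⌊ e ℚP.<? q ⌋
<-flip {e} {q} e≄q with ℚP.<-cmp e q
... | tri< e<q _ q≮e rewrite ⌊⌋-true (e ℚP.<? q) e<q = ⌊⌋-false (q ℚP.<? e) q≮e
... | tri≈ _ e≃q _   = ⊥-elim (e≄q e≃q)
... | tri> e≮q _ q<e rewrite ⌊⌋-false (e ℚP.<? q) e≮q = ⌊⌋-true (q ℚP.<? e) q<e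

-- Reflecting through 0 turns (0, e] into [-e, 0); the extra integer a = 0 lies in (-e, 0].
#nonposAbove-neg : ∀ m {e e′} → 0ℚᵘ ℚ.< e → (∀ s → 1 ℕ.≤ s → s ℕ.≤ m → ¬ (e ≃ ℤ→ℚ (+ s))) →
  e′ ≃ ℚ.- e → #nonposAbove m e′ ≡ suc (#posBelow m e)
#nonposAbove-neg m {e} {e′} 0<e generic e′≃-e =
  sum-intRange-pairs m (𝟙 ∘ nonposAbove e′) (𝟙 ∘ posBelow e) 1 zero-counted pairs
  where
  e′<0 : e′ ℚ.< 0ℚᵘ
  e′<0 = ℚP.<-respˡ-≃ (ℚP.≃-sym e′≃-e) (ℚP.neg-mono-< 0<e)
  zero-counted : 𝟙 (nonposAbove e′ (+ 0)) ≡ 1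
  zero-counted rewrite ⌊⌋-true (e′ ℚP.<? ℤ→ℚ (+ 0)) e′<0 = refl
  e′<-s⇔s<e : ∀ s → (e′ ℚ.< ℤ→ℚ (- + s)) ⇔ (ℤ→ℚ (+ s) ℚ.< e)
  e′<-s⇔s<e s = mk⇔ (λ p → ℚP.neg-cancel-< (ℚP.<-respˡ-≃ e′≃-e p))
                    (λ p → ℚP.<-respˡ-≃ (ℚP.≃-sym e′≃-e) (ℚP.neg-mono-< p))
  pairs : ∀ s → 1 ℕ.≤ s → s ℕ.≤ m →
    𝟙 (nonposAbove e′ (+ s)) ℕ.+ 𝟙 (nonposAbove e′ (- + s)) ≡ 𝟙 (posBelow e (+ s)) ℕ.+ 𝟙 (posBelow e (- + s))
  pairs (suc s) _ s<m = begin
    𝟙 ⌊ e′ ℚP.<? ℤ→ℚ (- + suc s) ⌋       ≡⟨ cong 𝟙 (⌊⌋-⇔ (e′<-s⇔s<e (suc s)) _ (ℤ→ℚ (+ suc s) ℚP.<? e)) ⟩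
    𝟙 ⌊ ℤ→ℚ (+ suc s) ℚP.<? e ⌋          ≡⟨ cong 𝟙 (<-flip (generic (suc s) (s≤s z≤n) s<m)) ⟩
    𝟙 (not ⌊ e ℚP.<? ℤ→ℚ (+ suc s) ⌋)    ≡⟨ ℕP.+-identityʳ _ ⟨
    𝟙 (posBelow e (+ suc s)) ℕ.+ 𝟙 (posBelow e (- + suc s)) ∎
    where open ≡-Reasoning

∈-⋃⁺ : ∀ {i : Fin n} {X} (Xs : List (Subset n)) → X ∈ᴸ Xs → i ∈ X → i ∈ L.foldr _∪_ ⊥ Xs
∈-⋃⁺ (X ∷ Xs) (here refl) i∈X = x∈p∪q⁺ (inj₁ i∈X)
∈-⋃⁺ (Y ∷ Xs) (there X∈) i∈X = x∈p∪q⁺ (inj₂ (∈-⋃⁺ Xs X∈ i∈X))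

∈-⋃⁻ : ∀ {i : Fin n} (Xs : List (Subset n)) → i ∈ L.foldr _∪_ ⊥ Xs → ∃[ X ] (X ∈ᴸ Xs × i ∈ X)
∈-⋃⁻ []       i∈ = ⊥-elim (∉⊥ i∈)
∈-⋃⁻ (Y ∷ Xs) i∈ with x∈p∪q⁻ Y (L.foldr _∪_ ⊥ Xs) i∈
... | inj₁ i∈Y = Y , here refl , i∈Y
... | inj₂ i∈⋃ = let X , X∈ , i∈X = ∈-⋃⁻ Xs i∈⋃ in X , there X∈ , i∈X

allSubsets-complete : (X : Subset n) → X ∈ᴸ allSubsets n
allSubsets-complete {zero}  Vec.[]          = here refl
allSubsets-complete {suc n} (true Vec.∷ X)  = ∈-concatMap⁺ (λ Y → (true Vec.∷ Y) ∷ (false Vec.∷ Y) ∷ [])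
  (Any.map (λ { refl → here refl }) (allSubsets-complete X))
allSubsets-complete {suc n} (false Vec.∷ X) = ∈-concatMap⁺ (λ Y → (true Vec.∷ Y) ∷ (false Vec.∷ Y) ∷ [])
  (Any.map (λ { refl → there (here refl) }) (allSubsets-complete X))

center-intro : ∀ p (c : Fin n → ℕ) X {i} → Admissible p c X → i ∈ X → i ∈ center p c
center-intro {n} p c X adm =
  ∈-⋃⁺ (filter (admissible? p c) (allSubsets n)) (∈-filter⁺ (admissible? p c) (allSubsets-complete X) adm)

center-elim : ∀ p (c : Fin n → ℕ) {i} → i ∈ center p c → ∃[ X ] (Admissible p c X × i ∈ X)
center-elim {n} p c i∈ =
  let X , X∈ , i∈X = ∈-⋃⁻ (filter (admissible? p c) (allSubsets n)) i∈
  in X , proj₂ (∈-filter⁻ (admissible? p c) {xs = allSubsets n} X∈) , i∈X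

invTable-id : (y : Fin n) → invTable (Perm.id {n}) y ≡ 0
invTable-id {n} y = trans (count≡sum {n} (λ v → ⌊ toℕ v ℕ.<? toℕ y ⌋ ∧ ⌊ toℕ y ℕ.<? toℕ v ⌋)) (sum-zero none)
  where
  none : (v : Fin n) → 𝟙 (⌊ toℕ v ℕ.<? toℕ y ⌋ ∧ ⌊ toℕ y ℕ.<? toℕ v ⌋) ≡ 0
  none v with toℕ v ℕ.<? toℕ y
  ... | no  _   = refl
  ... | yes v<y rewrite ⌊⌋-false (toℕ y ℕ.<? toℕ v) (ℕP.<-asym v<y) = refl

-- Counting y itself turns the strict inequalities of the inversion table into weak ones.
suc-invTable : (π : Permutation′ n) (y : Fin n) →
  suc (invTable π y) ≡ count (λ z → ⌊ toℕ (π ⟨$⟩ˡ z) ℕ.≤? toℕ (π ⟨$⟩ˡ y) ⌋ ∧ ⌊ toℕ y ℕ.≤? toℕ z ⌋)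
suc-invTable {n} π y = begin
  suc (invTable π y)
    ≡⟨ cong suc (trans (count≡sum inverted) (∑-permute (𝟙 ∘ inverted) (Perm.flip π))) ⟩
  suc (∑[ z < n ] 𝟙 (⌊ toℕ (π ⟨$⟩ˡ z) ℕ.<? toℕ (π ⟨$⟩ˡ y) ⌋ ∧ ⌊ toℕ y ℕ.<? toℕ (π ⟨$⟩ʳ (π ⟨$⟩ˡ z)) ⌋))
    ≡⟨ cong suc (sum-cong-≗ (λ z → cong (λ w → 𝟙 (⌊ toℕ (π ⟨$⟩ˡ z) ℕ.<? toℕ (π ⟨$⟩ˡ y) ⌋ ∧ ⌊ toℕ y ℕ.<? toℕ w ⌋)) (inverseʳ π))) ⟩
  suc (∑[ z < n ] strict z)                           ≡⟨ cong (ℕ._+ ∑[ z < n ] strict z) (sum-𝟙≟ y) ⟨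
  ∑[ z < n ] 𝟙 ⌊ z FinP.≟ y ⌋ ℕ.+ ∑[ z < n ] strict z ≡⟨ ∑-distrib-+ (λ z → 𝟙 ⌊ z FinP.≟ y ⌋) strict ⟨
  ∑[ z < n ] (𝟙 ⌊ z FinP.≟ y ⌋ ℕ.+ strict z)          ≡⟨ sum-cong-≗ weaken ⟩
  ∑[ z < n ] 𝟙 (⌊ toℕ (π ⟨$⟩ˡ z) ℕ.≤? toℕ (π ⟨$⟩ˡ y) ⌋ ∧ ⌊ toℕ y ℕ.≤? toℕ z ⌋) ≡⟨ count≡sum (λ z → ⌊ toℕ (π ⟨$⟩ˡ z) ℕ.≤? toℕ (π ⟨$⟩ˡ y) ⌋ ∧ ⌊ toℕ y ℕ.≤? toℕ z ⌋) ⟨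
  count (λ z → ⌊ toℕ (π ⟨$⟩ˡ z) ℕ.≤? toℕ (π ⟨$⟩ˡ y) ⌋ ∧ ⌊ toℕ y ℕ.≤? toℕ z ⌋) ∎
  where
  open ≡-Reasoning
  inverted : Fin n → Bool
  inverted j = ⌊ toℕ j ℕ.<? toℕ (π ⟨$⟩ˡ y) ⌋ ∧ ⌊ toℕ y ℕ.<? toℕ (π ⟨$⟩ʳ j) ⌋
  strict : Fin n → ℕ
  strict z = 𝟙 (⌊ toℕ (π ⟨$⟩ˡ z) ℕ.<? toℕ (π ⟨$⟩ˡ y) ⌋ ∧ ⌊ toℕ y ℕ.<? toℕ z ⌋)
  <⇔≤ : ∀ {a b : Fin n} → a ≢ b → (toℕ a ℕ.< toℕ b) ⇔ (toℕ a ℕ.≤ toℕ b)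
  <⇔≤ a≢b = mk⇔ ℕP.<⇒≤ (λ a≤b → ℕP.≤∧≢⇒< a≤b (a≢b ∘ FinP.toℕ-injective))
  weaken : ∀ z → 𝟙 ⌊ z FinP.≟ y ⌋ ℕ.+ strict z ≡ 𝟙 (⌊ toℕ (π ⟨$⟩ˡ z) ℕ.≤? toℕ (π ⟨$⟩ˡ y) ⌋ ∧ ⌊ toℕ y ℕ.≤? toℕ z ⌋)
  weaken z with z FinP.≟ y
  ... | yes refl rewrite ⌊⌋-false (toℕ (π ⟨$⟩ˡ z) ℕ.<? toℕ (π ⟨$⟩ˡ z)) (ℕP.<-irrefl refl)
                       | ⌊⌋-true (toℕ (π ⟨$⟩ˡ z) ℕ.≤? toℕ (π ⟨$⟩ˡ z)) ℕP.≤-refl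
                       | ⌊⌋-true (toℕ z ℕ.≤? toℕ z) ℕP.≤-refl = refl
  ... | no  z≢y = cong₂ (λ b c → 𝟙 (b ∧ c))
    (⌊⌋-⇔ (<⇔≤ (z≢y ∘ ⟨$⟩ˡ-injective π)) (toℕ (π ⟨$⟩ˡ z) ℕ.<? toℕ (π ⟨$⟩ˡ y)) (toℕ (π ⟨$⟩ˡ z) ℕ.≤? toℕ (π ⟨$⟩ˡ y)))
    (⌊⌋-⇔ (<⇔≤ (z≢y ∘ sym)) (toℕ y ℕ.<? toℕ z) (toℕ y ℕ.≤? toℕ z))

+[a+i]≤p+r : ∀ p {a i r} → + a ℤ.≤ p ℤ.+ + 1 → suc i ℕ.≤ r → + (a ℕ.+ i) ℤ.≤ p ℤ.+ + r
+[a+i]≤p+r p {a} {i} {r} a≤p+1 1+i≤r = begin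
  + (a ℕ.+ i)         ≡⟨ ℤP.pos-+ a i ⟩
  + a ℤ.+ + i         ≤⟨ ℤP.+-monoˡ-≤ (+ i) a≤p+1 ⟩
  p ℤ.+ + 1 ℤ.+ + i   ≡⟨ ℤP.+-assoc p (+ 1) (+ i) ⟩
  p ℤ.+ + suc i       ≤⟨ ℤP.+-monoʳ-≤ p (ℤ.+≤+ 1+i≤r) ⟩
  p ℤ.+ + r           ∎
  where open ℤP.≤-Reasoning

p+r<+[a+i] : ∀ p {a i r} → p ℤ.+ + 1 ℤ.< + a → r ℕ.≤ suc i → p ℤ.+ + r ℤ.< + (a ℕ.+ i)
p+r<+[a+i] p {a} {i} {r} p+1<a r≤1+i = begin-strict
  p ℤ.+ + r           ≤⟨ ℤP.+-monoʳ-≤ p (ℤ.+≤+ r≤1+i) ⟩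
  p ℤ.+ + suc i       ≡⟨ ℤP.+-assoc p (+ 1) (+ i) ⟨
  p ℤ.+ + 1 ℤ.+ + i   <⟨ ℤP.+-monoˡ-< (+ i) p+1<a ⟩
  + a ℤ.+ + i         ≡⟨ ℤP.pos-+ a i ⟨
  + (a ℕ.+ i)         ∎
  where open ℤP.≤-Reasoning

module _ {n : ℕ} (a c : Fin n → ℕ) (π : Permutation′ n)
  (a-mono : ∀ u u′ → toℕ u ℕ.≤ toℕ u′ → a u ℕ.≤ a u′)
  (c≡ : ∀ y → c y ≡ a (π ⟨$⟩ˡ y) ℕ.+ invTable π y) (p : ℤ) where

  private
    Low : Fin n → Set
    Low y = + a (π ⟨$⟩ˡ y) ℤ.≤ p ℤ.+ + 1

    Low? : ∀ y → Dec (Low y)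
    Low? y = + a (π ⟨$⟩ˡ y) ℤP.≤? p ℤ.+ + 1

    before? : (z y : Fin n) → Dec (toℕ (π ⟨$⟩ˡ z) ℕ.≤ toℕ (π ⟨$⟩ˡ y))
    before? z y = toℕ (π ⟨$⟩ˡ z) ℕ.≤? toℕ (π ⟨$⟩ˡ y)

    above? : (y z : Fin n) → Dec (toℕ y ℕ.≤ toℕ z)
    above? y z = toℕ y ℕ.≤? toℕ z

    low : Subset n
    low = Vec.tabulate (λ y → ⌊ Low? y ⌋)

    ∈low⇔ : ∀ {y} → y ∈ low ⇔ Low y
    ∈low⇔ {y} = mk⇔
      (λ y∈ → toWitness {a? = Low? y} (Equivalence.from T-≡ (trans (sym (lookup∘tabulate (λ y → ⌊ Low? y ⌋) y)) ([]=⇒lookup y∈))))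
      (λ l → lookup⇒[]= y low (trans (lookup∘tabulate (λ y → ⌊ Low? y ⌋) y) (⌊⌋-true (Low? y) l)))

    -- Everything weakly before y in π⁻¹-order and weakly above y is also in low.
    rank-low : ∀ y → Low y → suc (invTable π y) ℕ.≤ rank low y
    rank-low y l = subst (ℕ._≤ rank low y) (sym (suc-invTable π y)) (count-mono included)
      where
      included : ∀ z → T (⌊ before? z y ⌋ ∧ ⌊ above? y z ⌋) → T (⌊ z ∈? low ⌋ ∧ ⌊ above? y z ⌋)
      included z t = let before , y≤z = Equivalence.to (T-⌊⌋∧⌊⌋ (before? z y) (above? y z)) t in
        Equivalence.from (T-⌊⌋∧⌊⌋ (z ∈? low) (above? y z)) (Equivalence.from ∈low⇔ (ℤP.≤-trans (ℤ.+≤+ (a-mono _ _ before)) l) , y≤z)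

    admissible-low : Admissible p c low
    admissible-low y y∈ = subst (λ k → + k ℤ.≤ p ℤ.+ + rank low y) (sym (c≡ y))
      (+[a+i]≤p+r p (Equivalence.to ∈low⇔ y∈) (rank-low y (Equivalence.to ∈low⇔ y∈)))

    -- Downward induction on y: if all members of X above y are low, a high y would have too small a rank.
    admissible⇒low : ∀ X → Admissible p c X → ∀ y → y ∈ X → Low y
    admissible⇒low X adm = All.wfRec >-wellFounded 0ℓ (λ y → y ∈ X → Low y) step
      where
      step : ∀ y → (∀ {z} → toℕ y ℕ.< toℕ z → z ∈ X → Low z) → y ∈ X → Low y
      step y ih y∈X with Low? y
      ... | yes l    = l
      ... | no  high = ⊥-elim (ℤP.<⇒≱ (p+r<+[a+i] p (ℤP.≰⇒> high) rank≤)
                                      (subst (λ k → + k ℤ.≤ p ℤ.+ + rank X y) (c≡ y) (adm y y∈X)))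
        where
        included : ∀ z → T (⌊ z ∈? X ⌋ ∧ ⌊ above? y z ⌋) → T (⌊ before? z y ⌋ ∧ ⌊ above? y z ⌋)
        included z t = Equivalence.from (T-⌊⌋∧⌊⌋ (before? z y) (above? y z)) (before , y≤z)
          where
          z∈X×y≤z : z ∈ X × toℕ y ℕ.≤ toℕ z
          z∈X×y≤z = Equivalence.to (T-⌊⌋∧⌊⌋ (z ∈? X) (above? y z)) t
          y≤z : toℕ y ℕ.≤ toℕ z
          y≤z = proj₂ z∈X×y≤z
          before : toℕ (π ⟨$⟩ˡ z) ℕ.≤ toℕ (π ⟨$⟩ˡ y)
          before with ℕP.m≤n⇒m<n∨m≡n y≤z
          ... | inj₂ y≡z = ℕP.≤-reflexive (cong (toℕ ∘ (π ⟨$⟩ˡ_)) (sym (FinP.toℕ-injective y≡z)))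
          ... | inj₁ y<z = ℕP.<⇒≤ (ℕP.≰⇒> (λ y≤z′ → high
                  (ℤP.≤-trans (ℤ.+≤+ (a-mono _ _ y≤z′)) (ih y<z (proj₁ z∈X×y≤z)))))
        rank≤ : rank X y ℕ.≤ suc (invTable π y)
        rank≤ = subst (rank X y ℕ.≤_) (sym (suc-invTable π y)) (count-mono included)

  ∈center⇔ : ∀ y → y ∈ center p c ⇔ (+ a (π ⟨$⟩ˡ y) ℤ.≤ p ℤ.+ + 1)
  ∈center⇔ y = mk⇔
    (λ y∈ → let X , adm , y∈X = center-elim p c y∈ in admissible⇒low X adm y y∈X)
    (λ l → center-intro p c low admissible-low (Equivalence.from ∈low⇔ l))

module _ {n : ℕ} (m : ℕ) (x : Point (suc n)) (fund : InFundamental x) where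

  fundamental-antitone : ∀ u u′ → toℕ u ℕ.≤ toℕ u′ → x u′ ℚ.≤ x u
  fundamental-antitone u u′ u≤u′ with ℕP.m≤n⇒m<n∨m≡n u≤u′
  ... | inj₁ u<u′ = ℚP.<⇒≤ (fund u u′ u<u′)
  ... | inj₂ u≡u′ rewrite FinP.toℕ-injective u≡u′ = ℚP.≤-refl

  pairCount-above : ∀ u v → toℕ u ℕ.< toℕ v → pairCount m x u v ≡ 0
  pairCount-above u v u<v = trans (pairCount-outof m x u v u<v) (#nonposAbove-pos m (p<q⇒0<q-p (fund u v u<v)))

  pairCount-mono : ∀ u u′ v → toℕ u ℕ.≤ toℕ u′ → pairCount m x u v ℕ.≤ pairCount m x u′ v
  pairCount-mono u u′ v u≤u′ with ℕP.<-cmp (toℕ v) (toℕ u)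
  ... | tri< v<u _ _ = subst₂ ℕ._≤_ (sym (pairCount-into m x u v v<u)) (sym (pairCount-into m x u′ v (ℕP.<-≤-trans v<u u≤u′)))
          (#posBelow-mono m (ℚP.+-monoʳ-≤ (x v) (ℚP.neg-mono-≤ (fundamental-antitone u u′ u≤u′))))
  ... | tri≈ _ v≡u _ rewrite FinP.toℕ-injective v≡u | pairCount-self m x u = z≤n
  ... | tri> _ _ u<v rewrite pairCount-above u v u<v = z≤n

  label-mono : ∀ u u′ → toℕ u ℕ.≤ toℕ u′ → label m x u ℕ.≤ label m x u′
  label-mono u u′ u≤u′ = subst₂ ℕ._≤_ (sym (label≡suc-∑pairCount m x u)) (sym (label≡suc-∑pairCount m x u′))
    (s≤s (sum-mono-≤ (λ v → pairCount-mono u u′ v u≤u′)))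

  center-label⇔ : ∀ i q → i ∈ center q (label m x) ⇔ (+ label m x i ℤ.≤ q ℤ.+ + 1)
  center-label⇔ i q = ∈center⇔ (label m x) (label m x) Perm.id label-mono
    (λ z → sym (trans (cong (label m x z ℕ.+_) (invTable-id z)) (ℕP.+-identityʳ _))) q i

  module _ (generic : Generic m x) (π : Permutation′ (suc n)) where

    private
      y : Point (suc n)
      y = act π x

      y∘π≡x : ∀ v → y (π ⟨$⟩ʳ v) ≡ x v
      y∘π≡x v = cong x (inverseˡ π)

      diff∘π : ∀ v u → y (π ⟨$⟩ʳ v) ℚ.- y (π ⟨$⟩ʳ u) ≡ x v ℚ.- x u
      diff∘π v u = cong₂ ℚ._-_ (y∘π≡x v) (y∘π≡x u)

    pairCount-act-> : ∀ u v → toℕ u ℕ.< toℕ v → pairCount m y (π ⟨$⟩ʳ u) (π ⟨$⟩ʳ v) ≡ pairCount m x u v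
    pairCount-act-> u v u<v with ℕP.<-cmp (toℕ (π ⟨$⟩ʳ v)) (toℕ (π ⟨$⟩ʳ u))
    ... | tri< πv<πu _ _ = trans (pairCount-into m y _ _ πv<πu) (trans (cong (#posBelow m) (diff∘π v u))
      (trans (#posBelow-neg m (p<q⇒p-q<0 (fund u v u<v))) (sym (pairCount-above u v u<v))))
    ... | tri≈ _ πv≡πu _ = ⊥-elim (ℕP.<-irrefl (cong toℕ (⟨$⟩ʳ-injective π (FinP.toℕ-injective (sym πv≡πu)))) u<v)
    ... | tri> _ _ πu<πv = trans (pairCount-outof m y _ _ πu<πv) (trans (cong (#nonposAbove m) (diff∘π u v))
      (sym (pairCount-outof m x u v u<v)))

    -- A pair v < u whose order π reverses gains exactly the hyperplane x_u - x_v = 0.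
    pairCount-act-< : ∀ u v → toℕ v ℕ.< toℕ u → pairCount m y (π ⟨$⟩ʳ u) (π ⟨$⟩ʳ v) ≡
      pairCount m x u v ℕ.+ 𝟙 ⌊ toℕ (π ⟨$⟩ʳ u) ℕ.<? toℕ (π ⟨$⟩ʳ v) ⌋
    pairCount-act-< u v v<u rewrite pairCount-into m x u v v<u with ℕP.<-cmp (toℕ (π ⟨$⟩ʳ v)) (toℕ (π ⟨$⟩ʳ u))
    ... | tri< πv<πu _ πu≮πv rewrite ⌊⌋-false (toℕ (π ⟨$⟩ʳ u) ℕ.<? toℕ (π ⟨$⟩ʳ v)) πu≮πv =
      trans (pairCount-into m y _ _ πv<πu) (trans (cong (#posBelow m) (diff∘π v u)) (sym (ℕP.+-identityʳ _)))
    ... | tri≈ _ πv≡πu _ = ⊥-elim (ℕP.<-irrefl (cong toℕ (⟨$⟩ʳ-injective π (FinP.toℕ-injective πv≡πu))) v<u)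
    ... | tri> _ _ πu<πv rewrite ⌊⌋-true (toℕ (π ⟨$⟩ʳ u) ℕ.<? toℕ (π ⟨$⟩ʳ v)) πu<πv = begin
      pairCount m y (π ⟨$⟩ʳ u) (π ⟨$⟩ʳ v)    ≡⟨ pairCount-outof m y _ _ πu<πv ⟩
      #nonposAbove m (y (π ⟨$⟩ʳ u) ℚ.- y (π ⟨$⟩ʳ v)) ≡⟨ cong (#nonposAbove m) (diff∘π u v) ⟩
      #nonposAbove m (x u ℚ.- x v)           ≡⟨ #nonposAbove-neg m (p<q⇒0<q-p (fund v u v<u)) off-integers
                                                  (ℚP.≃-sym (neg-[p-q]≃q-p (x v) (x u))) ⟩
      suc (#posBelow m (x v ℚ.- x u))        ≡⟨ ℕP.+-comm 1 _ ⟩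
      #posBelow m (x v ℚ.- x u) ℕ.+ 1        ∎
      where
      open ≡-Reasoning
      off-integers : ∀ s → 1 ℕ.≤ s → s ℕ.≤ m → ¬ (x v ℚ.- x u ≃ ℤ→ℚ (+ s))
      off-integers s _ s≤m = generic v u v<u (+ s) (ℤP.≤-trans ℤP.neg-≤-pos (ℤ.+≤+ z≤n)) (ℤ.+≤+ s≤m)

    pairCount-act : ∀ u v → pairCount m y (π ⟨$⟩ʳ u) (π ⟨$⟩ʳ v) ≡
      pairCount m x u v ℕ.+ 𝟙 (⌊ toℕ v ℕ.<? toℕ u ⌋ ∧ ⌊ toℕ (π ⟨$⟩ʳ u) ℕ.<? toℕ (π ⟨$⟩ʳ v) ⌋)
    pairCount-act u v with ℕP.<-cmp (toℕ v) (toℕ u)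
    ... | tri< v<u _ _ rewrite ⌊⌋-true (toℕ v ℕ.<? toℕ u) v<u = pairCount-act-< u v v<u
    ... | tri≈ _ v≡u _ rewrite FinP.toℕ-injective v≡u | ⌊⌋-false (toℕ u ℕ.<? toℕ u) (ℕP.<-irrefl refl)
                             | pairCount-self m y (π ⟨$⟩ʳ u) | pairCount-self m x u = refl
    ... | tri> _ _ u<v rewrite ⌊⌋-false (toℕ v ℕ.<? toℕ u) (ℕP.<⇒≯ u<v) =
      trans (pairCount-act-> u v u<v) (sym (ℕP.+-identityʳ _))

    label-act-⟨$⟩ʳ : ∀ u → label m y (π ⟨$⟩ʳ u) ≡ label m x u ℕ.+ invTable π (π ⟨$⟩ʳ u)
    label-act-⟨$⟩ʳ u = begin
      label m y (π ⟨$⟩ʳ u)                                   ≡⟨ label≡suc-∑pairCount m y (π ⟨$⟩ʳ u) ⟩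
      suc (∑[ l < suc n ] pairCount m y (π ⟨$⟩ʳ u) l)         ≡⟨ cong suc (∑-permute (pairCount m y (π ⟨$⟩ʳ u)) π) ⟩
      suc (∑[ v < suc n ] pairCount m y (π ⟨$⟩ʳ u) (π ⟨$⟩ʳ v)) ≡⟨ cong suc (sum-cong-≗ (pairCount-act u)) ⟩
      suc (∑[ v < suc n ] (pairCount m x u v ℕ.+ inverted v)) ≡⟨ cong suc (∑-distrib-+ (pairCount m x u) inverted) ⟩
      suc (∑[ v < suc n ] pairCount m x u v ℕ.+ ∑[ v < suc n ] inverted v)
        ≡⟨ cong₂ ℕ._+_ (label≡suc-∑pairCount m x u) (count≡sum (λ v → ⌊ toℕ v ℕ.<? toℕ u ⌋ ∧ ⌊ toℕ (π ⟨$⟩ʳ u) ℕ.<? toℕ (π ⟨$⟩ʳ v) ⌋)) ⟨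
      label m x u ℕ.+ count (λ v → ⌊ toℕ v ℕ.<? toℕ u ⌋ ∧ ⌊ toℕ (π ⟨$⟩ʳ u) ℕ.<? toℕ (π ⟨$⟩ʳ v) ⌋)
        ≡⟨ cong (λ w → label m x u ℕ.+ count (λ v → ⌊ toℕ v ℕ.<? toℕ w ⌋ ∧ ⌊ toℕ (π ⟨$⟩ʳ u) ℕ.<? toℕ (π ⟨$⟩ʳ v) ⌋))
                (inverseˡ π) ⟨
      label m x u ℕ.+ invTable π (π ⟨$⟩ʳ u)                   ∎
      where
      open ≡-Reasoning
      inverted : Fin (suc n) → ℕ
      inverted v = 𝟙 (⌊ toℕ v ℕ.<? toℕ u ⌋ ∧ ⌊ toℕ (π ⟨$⟩ʳ u) ℕ.<? toℕ (π ⟨$⟩ʳ v) ⌋)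

    label-act : ∀ z → label m y z ≡ label m x (π ⟨$⟩ˡ z) ℕ.+ invTable π z
    label-act z = subst (λ w → label m y w ≡ label m x (π ⟨$⟩ˡ z) ℕ.+ invTable π w) (inverseʳ π) (label-act-⟨$⟩ʳ (π ⟨$⟩ˡ z))

    center-label-act⇔ : ∀ i q → i ∈ center q (label m (act π x)) ⇔ (+ label m x (π ⟨$⟩ˡ i) ℤ.≤ q ℤ.+ + 1)
    center-label-act⇔ i q = ∈center⇔ (label m x) (label m y) π label-mono label-act q i

[j-1]+1≡j : ∀ j → (j - + 1) ℤ.+ + 1 ≡ j
[j-1]+1≡j = solve-∀ℤ

isPAt⇔ : ∀ {c : Fin n → ℕ} {i t} → (∀ q → i ∈ center q c ⇔ (+ t ℤ.≤ q ℤ.+ + 1)) →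
  ∀ j → IsPAt c i j ⇔ (+ t ≡ j ℤ.+ + 1)
isPAt⇔ {c = c} {i} {t} Z j = mk⇔ to from
  where
  t≤j⇔ : i ∈ center (j - + 1) c ⇔ (+ t ℤ.≤ j)
  t≤j⇔ = subst (λ k → i ∈ center (j - + 1) c ⇔ (+ t ℤ.≤ k)) ([j-1]+1≡j j) (Z (j - + 1))
  to : IsPAt c i j → + t ≡ j ℤ.+ + 1
  to (i∈ , i∉) = ℤP.≤-antisym (Equivalence.to (Z j) i∈)
    (subst (ℤ._≤ + t) (ℤP.+-comm (+ 1) j) (ℤP.i<j⇒suc[i]≤j (ℤP.≰⇒> (i∉ ∘ Equivalence.from t≤j⇔))))
  from : + t ≡ j ℤ.+ + 1 → IsPAt c i j
  from t≡j+1 = Equivalence.from (Z j) (ℤP.≤-reflexive t≡j+1) , λ i∈ →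
    ℤP.<-irrefl refl (ℤP.suc[i]≤j⇒i<j (subst (ℤ._≤ j) (trans t≡j+1 (ℤP.+-comm j (+ 1))) (Equivalence.to t≤j⇔ i∈)))

+[t+k]-j≡1+k : ∀ {t k} j → + t ≡ j ℤ.+ + 1 → + (t ℕ.+ k) - j ≡ + 1 ℤ.+ + k
+[t+k]-j≡1+k {t} {k} j t≡j+1 = begin
  + (t ℕ.+ k) - j        ≡⟨ cong (_- j) (ℤP.pos-+ t k) ⟩
  + t ℤ.+ + k - j        ≡⟨ cong (λ s → s ℤ.+ + k - j) t≡j+1 ⟩
  j ℤ.+ + 1 ℤ.+ + k - j  ≡⟨ [j+1+k]-j≡1+k j (+ k) ⟩
  + 1 ℤ.+ + k            ∎
  where
  open ≡-Reasoning
  [j+1+k]-j≡1+k : ∀ j k → j ℤ.+ + 1 ℤ.+ k - j ≡ + 1 ℤ.+ k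
  [j+1+k]-j≡1+k = solve-∀ℤ

mainTheorem2 : (n m : ℕ) → 1 ≤ n → 1 ≤ m → (π : Permutation′ n) → (x : Point n) →
    Generic m x → InFundamental x → (p : ℕ) → p ≤ (m ∸ 1) * n →
    ((i : Fin n) → (i ∈ center (+ p) (label m x)) ⇔ ((π ⟨$⟩ʳ i) ∈ center (+ p) (label m (act π x))))
    × ((i j : Fin n) → IsPAt (label m x) i (+ p) → IsPAt (label m x) j (+ p) → label m x i ≡ label m x j)
    × ((i : Fin n) → (∃[ j ] IsPAt (label m (act π x)) i j)
        × ((j : ℤ) → IsPAt (label m (act π x)) i j → + (label m (act π x) i) - j ≡ + 1 Data.Integer.+ + (invTable π i)))
mainTheorem2 (suc n) m _ _ π x generic fund p _ =
  (λ i → ⇔-trans (Za i (+ p)) (⇔-sym (subst (λ w → (π ⟨$⟩ʳ i) ∈ center (+ p) b ⇔ (+ a w ℤ.≤ + p ℤ.+ + 1))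
                                             (inverseˡ π) (Zb (π ⟨$⟩ʳ i) (+ p))))) ,
  (λ i j i-at-p j-at-p → ℤP.+-injective (trans (Equivalence.to (isPAt⇔ (Za i) (+ p)) i-at-p)
                                               (sym (Equivalence.to (isPAt⇔ (Za j) (+ p)) j-at-p)))) ,
  λ i → (+ a (π ⟨$⟩ˡ i) - + 1 , Equivalence.from (isPAt⇔ (Zb i) (+ a (π ⟨$⟩ˡ i) - + 1)) (sym ([j-1]+1≡j (+ a (π ⟨$⟩ˡ i))))) ,
        λ j i-at-j → trans (cong (λ k → + k - j) (label-act m x fund generic π i))
                           (+[t+k]-j≡1+k j (Equivalence.to (isPAt⇔ (Zb i) j) i-at-j))
  where
  a b : Fin (suc n) → ℕ
  a = label m x
  b = label m (act π x)
  Za : ∀ i q → i ∈ center q a ⇔ (+ a i ℤ.≤ q ℤ.+ + 1)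
  Za = center-label⇔ m x fund
  Zb : ∀ i q → i ∈ center q b ⇔ (+ a (π ⟨$⟩ˡ i) ℤ.≤ q ℤ.+ + 1)
  Zb = center-label-act⇔ m x fund generic π
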